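{- Let $b$ be a positive integer and $t$ an integer with $0\le t\le b$ and $2t>b$. The lexicographically smallest element of $\Gamma(\{b-t,b-t+1,\ldots,t\})$ is the $2$-periodic sequence $(t\ (b-t))^{\infty}=t\ (b-t)\ t\ (b-t)\ t\ldots$.
   Context: $\{b-t,\ldots,t\}$ carries the natural order of the integers, and the bar operation on it is $\overline{x}=b-x$, extended letterwise to sequences. $\sigma$ denotes the shift $\sigma((a_n)_{n\ge0})=(a_{n+1})_{n\ge0}$, and $\le$ is the lexicographical order on sequences. For a finite ordered alphabet $\mathcal A$ with bar operation, $\Gamma(\mathcal A)$ is the set of sequences $A=(a_n)_{n\ge0}\in\mathcal A^{\mathbb N}$ with $a_0=\max\mathcal A$ and $\overline{A}\le\sigma^kA\le A$ for all $k\ge0$. -}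

module Defs where

open import Data.Nat using (ℕ; zero; suc)
open import Data.Nat.Properties using ()
open import Data.Integer using (ℤ; _-_; _≤_; _<_)
open import Data.Product using (_×_; Σ; ∃-syntax)
open import Data.Sum using (_⊎_)
open import Relation.Binary.PropositionalEquality using (_≡_)
import Data.Nat as N

Seq : Set
Seq = ℕ → ℤ

shift : ℕ → Seq → Seq
shift k A n = A (k N.+ n)

bar : ℤ → Seq → Seq
bar b A n = b - A n

_≤lex_ : Seq → Seq → Set
A ≤lex B = (∀ n → A n ≡ B n)
         ⊎ (∃[ m ] ((∀ i → i N.< m → A i ≡ B i) × A m < B m))

InAlphabet : ℤ → ℤ → Seq → Set
InAlphabet lo hi A = ∀ n → (lo ≤ A n) × (A n ≤ hi)

-- Γ({b-t,...,t}) with bar x ↦ b - x; max of the alphabet is t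
-- (the alphabet is nonempty when b - t ≤ t).
Γ : ℤ → ℤ → Seq → Set
Γ b t A = InAlphabet (b - t) t A
        × (A 0 ≡ t)
        × (∀ k → (bar b A ≤lex shift k A) × (shift k A ≤lex A))

alt : ℤ → ℤ → Seq
alt b t zero = t
alt b t (suc zero) = b - t
alt b t (suc (suc n)) = alt b t n

{-# OPTIONS --safe #-}
module Submission where

-- Since b - (b - t) = t, the shift of (t (b-t))^∞ is its bar, so its shifts are itself and its
-- bar, and 2t > b makes the bar strictly smaller.  Conversely, let A ∈ Γ with A₀ = t.  Its second
-- letter is at least b - t; if it is larger, (t (b-t))^∞ is already smaller at index 1.  Otherwise
-- A starts with t (b-t), and comparing σᵖA with A forces b - t after every t, while comparing σᵖA
-- with the bar of A forces t after every b - t, so A = (t (b-t))^∞.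

open import Defs
open import Data.Nat using (ℕ)
open import Data.Integer using (ℤ; +_)
open import Data.Product using (_×_)

open import Data.Nat using (zero; suc)
import Data.Nat as ℕ
import Data.Nat.Properties as ℕP
open import Data.Integer using (_-_; _*_; _≤_; _<_; +<+; _≟_)
import Data.Integer as ℤ
import Data.Integer.Properties as ℤP
open import Data.Integer.Tactic.RingSolver using (solve-∀)
open import Data.Product using (_,_; proj₁; proj₂)
open import Data.Sum using (_⊎_; inj₁; inj₂)
open import Data.Empty using (⊥-elim)
open import Function using (_∘′_)
open import Relation.Nullary using (yes; no)
open import Relation.Binary.PropositionalEquality

<-head⇒≤lex : ∀ {A B : Seq} → A 0 < B 0 → A ≤lex B
<-head⇒≤lex lt = inj₂ (0 , (λ _ ()) , lt)

<-second⇒≤lex : ∀ {A B : Seq} → A 0 ≡ B 0 → A 1 < B 1 → A ≤lex B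
<-second⇒≤lex {A} {B} eq lt = inj₂ (1 , agree , lt)
  where
  agree : ∀ i → i ℕ.< 1 → A i ≡ B i
  agree zero _ = eq
  agree (suc _) (ℕ.s≤s ())

≤lex∧head≡⇒second≤ : ∀ {A B : Seq} → A ≤lex B → A 0 ≡ B 0 → A 1 ≤ B 1
≤lex∧head≡⇒second≤ (inj₁ eq) _ = ℤP.≤-reflexive (eq 1)
≤lex∧head≡⇒second≤ (inj₂ (zero , _ , lt)) eq = ⊥-elim (ℤP.<-irrefl eq lt)
≤lex∧head≡⇒second≤ (inj₂ (suc zero , _ , lt)) _ = ℤP.<⇒≤ lt
≤lex∧head≡⇒second≤ (inj₂ (suc (suc m) , agree , _)) _ = ℤP.≤-reflexive (agree 1 (ℕ.s≤s (ℕ.s≤s ℕ.z≤n)))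

bar-involutive : ∀ b x → b - (b - x) ≡ x
bar-involutive = solve-∀

module _ (B T : ℤ) where

  private
    α : Seq
    α = alt B T

  alt-suc : ∀ n → α (suc n) ≡ B - α n
  alt-suc zero = refl
  alt-suc (suc zero) = sym (bar-involutive B T)
  alt-suc (suc (suc n)) = alt-suc n

  alt-letters : ∀ n → α n ≡ T ⊎ α n ≡ B - T
  alt-letters zero = inj₁ refl
  alt-letters (suc zero) = inj₂ refl
  alt-letters (suc (suc n)) = alt-letters n

  shift-alt : ∀ k → shift k α ≗ α ⊎ shift k α ≗ bar B α
  shift-alt zero = inj₁ (λ _ → refl)
  shift-alt (suc zero) = inj₂ alt-suc
  shift-alt (suc (suc k)) = shift-alt k

  alt∈Γ : B - T < T → Γ B T α
  alt∈Γ B-T<T = letters , refl , comparisons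
    where
    letters : InAlphabet (B - T) T α
    letters n with alt-letters n
    ... | inj₁ αn≡T = subst (λ x → B - T ≤ x × x ≤ T) (sym αn≡T) (ℤP.<⇒≤ B-T<T , ℤP.≤-refl)
    ... | inj₂ αn≡B-T = subst (λ x → B - T ≤ x × x ≤ T) (sym αn≡B-T) (ℤP.≤-refl , ℤP.<⇒≤ B-T<T)

    comparisons : ∀ k → (bar B α ≤lex shift k α) × (shift k α ≤lex α)
    comparisons k with shift-alt k
    ... | inj₁ σα≗α = <-head⇒≤lex (subst (B - T <_) (sym (σα≗α 0)) B-T<T) , inj₁ σα≗α
    ... | inj₂ σα≗ᾱ = inj₁ (λ n → sym (σα≗ᾱ n)) , <-head⇒≤lex (subst (_< T) (sym (σα≗ᾱ 0)) B-T<T)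

  module _ {A : Seq} (A∈Γ : Γ B T A) (A₁≡B-T : A 1 ≡ B - T) where

    private
      letters : InAlphabet (B - T) T A
      letters = proj₁ A∈Γ

      A₀≡T : A 0 ≡ T
      A₀≡T = proj₁ (proj₂ A∈Γ)

      shift-head : ∀ p → shift p A 0 ≡ A p
      shift-head p = cong A (ℕP.+-identityʳ p)

      shift-second : ∀ p → shift p A 1 ≡ A (suc p)
      shift-second p = cong A (ℕP.+-comm p 1)

    top-followed-by-bottom : ∀ p → A p ≡ T → A (suc p) ≡ B - T
    top-followed-by-bottom p Ap≡T = ℤP.≤-antisym Aₚ₊₁≤B-T (proj₁ (letters (suc p)))
      where
      Aₚ₊₁≤B-T : A (suc p) ≤ B - T
      Aₚ₊₁≤B-T = subst₂ _≤_ (shift-second p) A₁≡B-T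
        (≤lex∧head≡⇒second≤ (proj₂ (proj₂ (proj₂ A∈Γ) p))
          (trans (shift-head p) (trans Ap≡T (sym A₀≡T))))

    bottom-followed-by-top : ∀ p → A p ≡ B - T → A (suc p) ≡ T
    bottom-followed-by-top p Ap≡B-T = ℤP.≤-antisym (proj₂ (letters (suc p))) T≤Aₚ₊₁
      where
      T≤Aₚ₊₁ : T ≤ A (suc p)
      T≤Aₚ₊₁ = subst₂ _≤_ (trans (cong (B -_) A₁≡B-T) (bar-involutive B T)) (shift-second p)
        (≤lex∧head≡⇒second≤ (proj₁ (proj₂ (proj₂ A∈Γ) p))
          (trans (cong (B -_) A₀≡T) (sym (trans (shift-head p) Ap≡B-T))))

    Γ∧second≡bottom⇒≗alt : A ≗ α
    Γ∧second≡bottom⇒≗alt zero = A₀≡T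
    Γ∧second≡bottom⇒≗alt (suc n) with alt-letters n
    ... | inj₁ αn≡T = begin
      A (suc n)   ≡⟨ top-followed-by-bottom n (trans (Γ∧second≡bottom⇒≗alt n) αn≡T) ⟩
      B - T       ≡⟨ cong (B -_) αn≡T ⟨
      B - α n     ≡⟨ alt-suc n ⟨
      α (suc n)   ∎
      where open ≡-Reasoning
    ... | inj₂ αn≡B-T = begin
      A (suc n)   ≡⟨ bottom-followed-by-top n (trans (Γ∧second≡bottom⇒≗alt n) αn≡B-T) ⟩
      T           ≡⟨ bar-involutive B T ⟨
      B - (B - T) ≡⟨ cong (B -_) αn≡B-T ⟨
      B - α n     ≡⟨ alt-suc n ⟨
      α (suc n)   ∎
      where open ≡-Reasoning

  alt-≤lex-Γ : ∀ A → Γ B T A → α ≤lex A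
  alt-≤lex-Γ A A∈Γ@(letters , A₀≡T , _) with A 1 ≟ B - T
  ... | yes A₁≡B-T = inj₁ (λ n → sym (Γ∧second≡bottom⇒≗alt A∈Γ A₁≡B-T n))
  ... | no A₁≢B-T = <-second⇒≤lex (sym A₀≡T) (ℤP.≤∧≢⇒< (proj₁ (letters 1)) (A₁≢B-T ∘′ sym))

m<2n⇒m-n<n : ∀ {m n} → m ℕ.< 2 ℕ.* n → + m - + n < + n
m<2n⇒m-n<n {m} {n} m<2n = begin-strict
  + m - + n           <⟨ ℤP.+-monoˡ-< (ℤ.- (+ n)) (+<+ m<2n) ⟩
  + (2 ℕ.* n) - + n   ≡⟨ cong (_- + n) (ℤP.pos-* 2 n) ⟩
  + 2 * + n - + n     ≡⟨ twice-minus-once (+ n) ⟩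
  + n                 ∎
  where
  open ℤP.≤-Reasoning
  twice-minus-once : ∀ x → + 2 * x - x ≡ x
  twice-minus-once = solve-∀

proposition2p8 : (b t : ℕ) → 0 Data.Nat.< b → t Data.Nat.≤ b → b Data.Nat.< 2 Data.Nat.* t →
    Γ (+ b) (+ t) (alt (+ b) (+ t))
    × (∀ A → Γ (+ b) (+ t) A → alt (+ b) (+ t) ≤lex A)
proposition2p8 b t _ _ b<2t = alt∈Γ (+ b) (+ t) (m<2n⇒m-n<n b<2t) , alt-≤lex-Γ (+ b) (+ t)
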